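{- For every ordinal $\alpha$, $(T_\alpha,P_\alpha)\le(T_{\alpha+1},P_{\alpha+1})$, where $(T_\alpha,P_\alpha)_{\alpha\in\mathrm{On}}$ is the transfinite sequence defined in the context.
   Context: Interpretations are pairs $(T,P)$, $T=(T^+,T^-)$, $P=(P^+,P^-)$, subsets of $\omega$ (codes of sentences of $\mathcal L=\mathcal L_{\mathbb N}\cup\{T,P\}$, Tait-style language with negation defined by De Morgan and $\neg\neg\varphi:=\varphi$); $\models_{SK}$ is Strong Kleene satisfaction in $(\mathbb N,T,P)$ ($Tt$ iff $\mathrm{val}(t)\in T^+$, $\neg Tt$ iff $\mathrm{val}(t)\in T^-$, likewise $P$). $\Pi(x)$ is an arithmetical formula representing the sentences $\varphi$ such that $\varphi$ or $\neg\varphi$ is $\mathrm{PA}[\mathrm{SK}]$-equivalent to its own untruth. $\mathscr P(x)$: $x$ is a sentence and one of: $\Pi(x)$; $x=Ts$ and $P\,\mathrm{val}(s)$; $x=\neg Ts$ and $P\,\mathrm{val}(s)$; $x=\psi\wedge\theta$ and $(P\psi\wedge P\theta)\vee(T\psi\wedge P\theta)\vee(T\theta\wedge P\psi)$; $x=\psi\vee\theta$ and $(P\psi\wedge P\theta)\vee(\neg T\psi\wedge P\theta)\vee(\neg T\theta\wedge P\psi)$; $x=\forall v\psi$ and $\exists yP\psi(\dot y)\wedge\forall y(P\psi(\dot y)\vee T\psi(\dot y))$; $x=\exists v\psi$ and $\exists yP\psi(\dot y)\wedge\forall y(P\psi(\dot y)\vee\neg T\psi(\dot y))$. $\Gamma_{\mathscr{TP}}(T,P)=\big((\{\#\varphi:\models_{SK}\varphi\},\{\#\varphi:\models_{SK}\neg\varphi\}),(\{\#\varphi:\models_{SK}\mathscr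 P(\ulcorner\varphi\urcorner)\},\{\#\varphi:\models_{SK}\varphi\vee\neg\varphi\})\big)$, satisfaction taken in $(\mathbb N,T,P)$. Sequence: $(T_0,P_0)=((\emptyset,\emptyset),(\emptyset,\emptyset))$, $(T_{\beta+1},P_{\beta+1})=\Gamma_{\mathscr{TP}}(T_\beta,P_\beta)$, componentwise unions at limits. $\le$ is componentwise inclusion. -}

module Defs where

open import Data.Nat using (ℕ; zero; suc; _+_; _*_; _^_)
open import Data.Fin using (Fin; zero; suc; toℕ)
open import Data.Product using (Σ; _×_; _,_)
open import Data.Sum using (_⊎_)
open import Data.Empty using (⊥)
open import Data.Unit using (⊤)
open import Relation.Nullary using (¬_)
open import Relation.Binary.PropositionalEquality using (_≡_)

data Tm (n : ℕ) : Set where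
  var  : Fin n → Tm n
  `0   : Tm n
  `S   : Tm n → Tm n
  _`+_ : Tm n → Tm n → Tm n
  _`*_ : Tm n → Tm n → Tm n

data Fm (n : ℕ) : Set where
  _≐_  : Tm n → Tm n → Fm n
  _≠_  : Tm n → Tm n → Fm n
  T    : Tm n → Fm n
  ¬T   : Tm n → Fm n
  P    : Tm n → Fm n
  ¬P   : Tm n → Fm n
  _∧_  : Fm n → Fm n → Fm n
  _∨_  : Fm n → Fm n → Fm n
  all  : Fm (suc n) → Fm n
  ex   : Fm (suc n) → Fm n

Sentence : Set
Sentence = Fm 0

-- Negation defined by De Morgan (so that ¬¬φ is φ).
neg : ∀ {n} → Fm n → Fm n
neg (s ≐ t) = s ≠ t
neg (s ≠ t) = s ≐ t
neg (T t)   = ¬T t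
neg (¬T t)  = T t
neg (P t)   = ¬P t
neg (¬P t)  = P t
neg (φ ∧ ψ) = neg φ ∨ neg ψ
neg (φ ∨ ψ) = neg φ ∧ neg ψ
neg (all φ) = ex (neg φ)
neg (ex φ)  = all (neg φ)

Arith : ∀ {n} → Fm n → Set
Arith (s ≐ t) = ⊤
Arith (s ≠ t) = ⊤
Arith (T t)   = ⊥
Arith (¬T t)  = ⊥
Arith (P t)   = ⊥
Arith (¬P t)  = ⊥
Arith (φ ∧ ψ) = Arith φ × Arith ψ
Arith (φ ∨ ψ) = Arith φ × Arith ψ
Arith (all φ) = Arith φ
Arith (ex φ)  = Arith φ

ren : ∀ {m n} → (Fin m → Fin n) → Tm m → Tm n
ren r (var i)  = var (r i)
ren r `0       = `0
ren r (`S t)   = `S (ren r t)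
ren r (s `+ t) = ren r s `+ ren r t
ren r (s `* t) = ren r s `* ren r t

subT : ∀ {m n} → (Fin m → Tm n) → Tm m → Tm n
subT σ (var i)  = σ i
subT σ `0       = `0
subT σ (`S t)   = `S (subT σ t)
subT σ (s `+ t) = subT σ s `+ subT σ t
subT σ (s `* t) = subT σ s `* subT σ t

liftS : ∀ {m n} → (Fin m → Tm n) → Fin (suc m) → Tm (suc n)
liftS σ zero    = var zero
liftS σ (suc i) = ren suc (σ i)

subF : ∀ {m n} → (Fin m → Tm n) → Fm m → Fm n
subF σ (s ≐ t) = subT σ s ≐ subT σ t
subF σ (s ≠ t) = subT σ s ≠ subT σ t
subF σ (T t)   = T (subT σ t)
subF σ (¬T t)  = ¬T (subT σ t)
subF σ (P t)   = P (subT σ t)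
subF σ (¬P t)  = ¬P (subT σ t)
subF σ (φ ∧ ψ) = subF σ φ ∧ subF σ ψ
subF σ (φ ∨ ψ) = subF σ φ ∨ subF σ ψ
subF σ (all φ) = all (subF (liftS σ) φ)
subF σ (ex φ)  = ex (subF (liftS σ) φ)

num : ∀ {n} → ℕ → Tm n
num zero    = `0
num (suc k) = `S (num k)

inst : Fm 1 → ℕ → Sentence
inst ψ y = subF (λ _ → num y) ψ

-- Gödel coding  (pairing ⟨a,b⟩ = 2^a * (2b+1), injective)

pair : ℕ → ℕ → ℕ
pair a b = (2 ^ a) * (suc (2 * b))

#t : ∀ {n} → Tm n → ℕ
#t (var i)  = pair 0 (toℕ i)
#t `0       = pair 1 0
#t (`S t)   = pair 2 (#t t)
#t (s `+ t) = pair 3 (pair (#t s) (#t t))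
#t (s `* t) = pair 4 (pair (#t s) (#t t))

# : ∀ {n} → Fm n → ℕ
# (s ≐ t) = pair 0 (pair (#t s) (#t t))
# (s ≠ t) = pair 1 (pair (#t s) (#t t))
# (T t)   = pair 2 (#t t)
# (¬T t)  = pair 3 (#t t)
# (P t)   = pair 4 (#t t)
# (¬P t)  = pair 5 (#t t)
# (φ ∧ ψ) = pair 6 (pair (# φ) (# ψ))
# (φ ∨ ψ) = pair 7 (pair (# φ) (# ψ))
# (all φ) = pair 8 (# φ)
# (ex φ)  = pair 9 (# φ)

-- Interpretations (T,P) = ((T⁺,T⁻),(P⁺,P⁻)), subsets of ω

record Interp : Set₁ where
  field
    T⁺ T⁻ P⁺ P⁻ : ℕ → Set
open Interp public

_≤I_ : Interp → Interp → Set
I ≤I J = (∀ k → T⁺ I k → T⁺ J k) × (∀ k → T⁻ I k → T⁻ J k)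
       × (∀ k → P⁺ I k → P⁺ J k) × (∀ k → P⁻ I k → P⁻ J k)

Env : ℕ → Set
Env n = Fin n → ℕ

_∷ₑ_ : ∀ {n} → ℕ → Env n → Env (suc n)
(k ∷ₑ ρ) zero    = k
(k ∷ₑ ρ) (suc i) = ρ i

∅ₑ : Env 0
∅ₑ ()

⟦_⟧ : ∀ {n} → Tm n → Env n → ℕ
⟦ var i ⟧  ρ = ρ i
⟦ `0 ⟧     ρ = 0
⟦ `S t ⟧   ρ = suc (⟦ t ⟧ ρ)
⟦ s `+ t ⟧ ρ = ⟦ s ⟧ ρ + ⟦ t ⟧ ρ
⟦ s `* t ⟧ ρ = ⟦ s ⟧ ρ * ⟦ t ⟧ ρ

val : Tm 0 → ℕ
val t = ⟦ t ⟧ ∅ₑ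

Sat : ∀ {n} → Interp → Env n → Fm n → Set
Sat I ρ (s ≐ t) = ⟦ s ⟧ ρ ≡ ⟦ t ⟧ ρ
Sat I ρ (s ≠ t) = ¬ (⟦ s ⟧ ρ ≡ ⟦ t ⟧ ρ)
Sat I ρ (T t)   = T⁺ I (⟦ t ⟧ ρ)
Sat I ρ (¬T t)  = T⁻ I (⟦ t ⟧ ρ)
Sat I ρ (P t)   = P⁺ I (⟦ t ⟧ ρ)
Sat I ρ (¬P t)  = P⁻ I (⟦ t ⟧ ρ)
Sat I ρ (φ ∧ ψ) = Sat I ρ φ × Sat I ρ ψ
Sat I ρ (φ ∨ ψ) = Sat I ρ φ ⊎ Sat I ρ ψ
Sat I ρ (all φ) = ∀ k → Sat I (k ∷ₑ ρ) φ
Sat I ρ (ex φ)  = Σ ℕ λ k → Sat I (k ∷ₑ ρ) φ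

_⊨_ : Interp → Sentence → Set
I ⊨ φ = Sat I ∅ₑ φ

-- ⊨_SK 𝒫(⌜φ⌝), with the syntactic (arithmetical) clauses of 𝒫 evaluated.
-- Π is the arithmetical formula (one free variable) representing the
-- "paradoxical" sentences.

𝒫-clauses : Interp → Sentence → Set
𝒫-clauses I (T s)   = P⁺ I (val s)
𝒫-clauses I (¬T s)  = P⁺ I (val s)
𝒫-clauses I (ψ ∧ θ) = (P⁺ I (# ψ) × P⁺ I (# θ))
                    ⊎ (T⁺ I (# ψ) × P⁺ I (# θ))
                    ⊎ (T⁺ I (# θ) × P⁺ I (# ψ))
𝒫-clauses I (ψ ∨ θ) = (P⁺ I (# ψ) × P⁺ I (# θ))
                    ⊎ (T⁻ I (# ψ) × P⁺ I (# θ))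
                    ⊎ (T⁻ I (# θ) × P⁺ I (# ψ))
𝒫-clauses I (all ψ) = (Σ ℕ λ y → P⁺ I (# (inst ψ y)))
                    × (∀ y → P⁺ I (# (inst ψ y)) ⊎ T⁺ I (# (inst ψ y)))
𝒫-clauses I (ex ψ)  = (Σ ℕ λ y → P⁺ I (# (inst ψ y)))
                    × (∀ y → P⁺ I (# (inst ψ y)) ⊎ T⁻ I (# (inst ψ y)))
𝒫-clauses I _       = ⊥

Sat𝒫 : Fm 1 → Interp → Sentence → Set
Sat𝒫 Π I φ = Sat I (λ _ → # φ) Π ⊎ 𝒫-clauses I φ

Γ : Fm 1 → Interp → Interp
T⁺ (Γ Π I) k = Σ Sentence λ φ → (k ≡ # φ) × (I ⊨ φ)
T⁻ (Γ Π I) k = Σ Sentence λ φ → (k ≡ # φ) × (I ⊨ neg φ)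
P⁺ (Γ Π I) k = Σ Sentence λ φ → (k ≡ # φ) × Sat𝒫 Π I φ
P⁻ (Γ Π I) k = Σ Sentence λ φ → (k ≡ # φ) × (I ⊨ (φ ∨ neg φ))

-- Ordinals as (Brouwer) well-founded trees with limits over arbitrary
-- index sets, and the transfinite sequence (T_α, P_α).

data Ord : Set₁ where
  ozero : Ord
  osuc  : Ord → Ord
  olim  : (I : Set) → (I → Ord) → Ord

emptyI : Interp
T⁺ emptyI _ = ⊥
T⁻ emptyI _ = ⊥
P⁺ emptyI _ = ⊥
P⁻ emptyI _ = ⊥

stage : Fm 1 → Ord → Interp
stage Π ozero      = emptyI
stage Π (osuc α)   = Γ Π (stage Π α)
T⁺ (stage Π (olim I f)) k = Σ I λ i → T⁺ (stage Π (f i)) k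
T⁻ (stage Π (olim I f)) k = Σ I λ i → T⁻ (stage Π (f i)) k
P⁺ (stage Π (olim I f)) k = Σ I λ i → P⁺ (stage Π (f i)) k
P⁻ (stage Π (olim I f)) k = Σ I λ i → P⁻ (stage Π (f i)) k

{-# OPTIONS --safe #-}
module Submission where

open import Data.Product using (Σ; _×_; _,_)
import Data.Product as Product
import Data.Sum as Sum
open import Function using (_∘_)
open import Relation.Binary.PropositionalEquality using (_≡_)

open import Defs

-- Strong Kleene satisfaction and the clauses of 𝒫 use T and P only
-- positively, so Γ is monotone.  The sequence then increases by induction:
-- the empty interpretation is least, monotonicity handles successors, and a
-- limit stage is the least upper bound of stages each of which lies below its
-- successor, hence below the successor of the limit.

≤I-trans : ∀ {I J K} → I ≤I J → J ≤I K → I ≤I K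
≤I-trans (t⁺ , t⁻ , p⁺ , p⁻) (t⁺′ , t⁻′ , p⁺′ , p⁻′) =
  (λ k → t⁺′ k ∘ t⁺ k) , (λ k → t⁻′ k ∘ t⁻ k) ,
  (λ k → p⁺′ k ∘ p⁺ k) , (λ k → p⁻′ k ∘ p⁻ k)

emptyI-least : ∀ I → emptyI ≤I I
emptyI-least I = (λ _ ()) , (λ _ ()) , (λ _ ()) , (λ _ ())

Sat-mono : ∀ {n I J} → I ≤I J → (ρ : Env n) (φ : Fm n) → Sat I ρ φ → Sat J ρ φ
Sat-mono le ρ (s ≐ t) h = h
Sat-mono le ρ (s ≠ t) h = h
Sat-mono (t⁺ , _ , _ , _) ρ (T t)  h = t⁺ _ h
Sat-mono (_ , t⁻ , _ , _) ρ (¬T t) h = t⁻ _ h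
Sat-mono (_ , _ , p⁺ , _) ρ (P t)  h = p⁺ _ h
Sat-mono (_ , _ , _ , p⁻) ρ (¬P t) h = p⁻ _ h
Sat-mono le ρ (φ ∧ ψ) = Product.map (Sat-mono le ρ φ) (Sat-mono le ρ ψ)
Sat-mono le ρ (φ ∨ ψ) = Sum.map (Sat-mono le ρ φ) (Sat-mono le ρ ψ)
Sat-mono le ρ (all φ) h k = Sat-mono le (k ∷ₑ ρ) φ (h k)
Sat-mono le ρ (ex φ) (k , h) = k , Sat-mono le (k ∷ₑ ρ) φ h

𝒫-clauses-mono : ∀ {I J} → I ≤I J → (φ : Sentence) → 𝒫-clauses I φ → 𝒫-clauses J φ
𝒫-clauses-mono (_ , _ , p⁺ , _) (T s)  = p⁺ _
𝒫-clauses-mono (_ , _ , p⁺ , _) (¬T s) = p⁺ _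
𝒫-clauses-mono (t⁺ , _ , p⁺ , _) (ψ ∧ θ) =
  Sum.map (Product.map (p⁺ _) (p⁺ _))
          (Sum.map (Product.map (t⁺ _) (p⁺ _)) (Product.map (t⁺ _) (p⁺ _)))
𝒫-clauses-mono (_ , t⁻ , p⁺ , _) (ψ ∨ θ) =
  Sum.map (Product.map (p⁺ _) (p⁺ _))
          (Sum.map (Product.map (t⁻ _) (p⁺ _)) (Product.map (t⁻ _) (p⁺ _)))
𝒫-clauses-mono (t⁺ , _ , p⁺ , _) (all ψ) =
  Product.map (Product.map₂ (p⁺ _)) (λ f y → Sum.map (p⁺ _) (t⁺ _) (f y))
𝒫-clauses-mono (_ , t⁻ , p⁺ , _) (ex ψ) =
  Product.map (Product.map₂ (p⁺ _)) (λ f y → Sum.map (p⁺ _) (t⁻ _) (f y))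

Sat𝒫-mono : ∀ Π {I J} → I ≤I J → (φ : Sentence) → Sat𝒫 Π I φ → Sat𝒫 Π J φ
Sat𝒫-mono Π le φ = Sum.map (Sat-mono le _ Π) (𝒫-clauses-mono le φ)

Γ-mono : ∀ Π {I J} → I ≤I J → Γ Π I ≤I Γ Π J
Γ-mono Π le =
  on-codes (Sat-mono le ∅ₑ) , on-codes (Sat-mono le ∅ₑ ∘ neg) ,
  on-codes (Sat𝒫-mono Π le) , on-codes (λ φ → Sat-mono le ∅ₑ (φ ∨ neg φ))
  where
  on-codes : {A B : Sentence → Set} → (∀ φ → A φ → B φ) →
             ∀ k → Σ Sentence (λ φ → (k ≡ # φ) × A φ) → Σ Sentence (λ φ → (k ≡ # φ) × B φ)
  on-codes f k (φ , k≡#φ , h) = φ , k≡#φ , f φ h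

stage-≤I-olim : ∀ Π {A} (f : A → Ord) i → stage Π (f i) ≤I stage Π (olim A f)
stage-≤I-olim Π f i = (λ _ → i ,_) , (λ _ → i ,_) , (λ _ → i ,_) , (λ _ → i ,_)

olim-least : ∀ Π {A} (f : A → Ord) {J} → (∀ i → stage Π (f i) ≤I J) → stage Π (olim A f) ≤I J
olim-least Π f below =
  (λ k (i , h) → let (t⁺ , _ , _ , _) = below i in t⁺ k h) ,
  (λ k (i , h) → let (_ , t⁻ , _ , _) = below i in t⁻ k h) ,
  (λ k (i , h) → let (_ , _ , p⁺ , _) = below i in p⁺ k h) ,
  (λ k (i , h) → let (_ , _ , _ , p⁻) = below i in p⁻ k h)

mainTheorem5 : (Π : Fm 1) → Arith Π → (α : Ord) → stage Π α ≤I stage Π (osuc α)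
mainTheorem5 Π _ ozero = emptyI-least _
mainTheorem5 Π arith (osuc α) = Γ-mono Π (mainTheorem5 Π arith α)
mainTheorem5 Π arith (olim A f) = olim-least Π f λ i →
  ≤I-trans (mainTheorem5 Π arith (f i)) (Γ-mono Π (stage-≤I-olim Π f i))
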